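{- Let $n\ge1$ and let $\sigma\in B_n$ have B-code $b=(b_1,\ldots,b_n)$. Then $$sor_B(\sigma)=\sum_{i=1}^n\bigl(i-b_i-\chi(b_i<0)\bigr)\qquad\text{and}\qquad l_B'(\sigma)=n-|\mathrm{Max}\,b|.$$
   Context: $B_n$ is the group of bijections $\sigma$ of $\{\pm1,\ldots,\pm n\}$ with $\sigma(-i)=-\sigma(i)$; products are composition. The B-code of $\sigma$ is $(b_1,\ldots,b_n)$ with $b_i=\sigma^{ -k_i}(i)$, where $k_i$ is the least $k\ge1$ with $|\sigma^{ -k}(i)|\le i$. $\mathrm{Max}\,b=\{i:b_i=i\}$; $\chi(P)\in\{0,1\}$ is the indicator of $P$. Reflections: for $1\le i<j\le n$, $(i,j)$ exchanges $i,j$ and exchanges $-i,-j$; for $1\le i<j\le n$, $(-i,j)$ exchanges $-i,j$ and exchanges $i,-j$; for $1\le j\le n$, $(-j,j)$ exchanges $j,-j$; all other points fixed. $T^B$ is the set of these reflections. Every $\sigma\in B_n$ has a unique factorization $\sigma=(i_1,j_1)\cdots(i_m,j_m)$ with $(i_r,j_r)\in T^B$ and $0<j_1<\cdots<j_m\le n$; then $sor_B(\sigma)=\sum_{r=1}^m(j_r-i_r-\chi(i_r<0))$. $l_B'(\sigma)$ is the minimal number of elements of $T^B$ whose product is $\sigma$. -}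

module Defs where

open import Data.Bool using (Bool; true; false; not)
open import Data.Nat as ℕ using (ℕ; zero; suc)
open import Data.Fin as Fin using (Fin; toℕ; _≟_)
open import Data.Fin.Properties using () renaming (_≟_ to _≟F_)
open import Data.Bool.Properties using () renaming (_≟_ to _≟B_)
open import Data.Integer as ℤ using (ℤ; +_; -_)
open import Data.List using (List; []; _∷_; foldr; map; filter; length; allFin)
open import Data.List.Relation.Unary.Linked using (Linked)
open import Data.Product using (_×_; _,_; ∃-syntax)
open import Data.Product.Properties using (≡-dec)
open import Function.Bundles using (_↔_; Inverse)
open import Relation.Binary.PropositionalEquality using (_≡_)
open import Relation.Nullary using (Dec; yes; no)

-- Signed points ±1,…,±n : (s , a) with a : Fin n encoding |x| = toℕ a + 1,
-- and s = true meaning the point is negative.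
SFin : ℕ → Set
SFin n = Bool × Fin n

pos : ∀ {n} → Fin n → SFin n
pos a = (false , a)

negate : ∀ {n} → SFin n → SFin n
negate (s , a) = (not s , a)

absℕ : ∀ {n} → SFin n → ℕ
absℕ (_ , a) = suc (toℕ a)

val : ∀ {n} → SFin n → ℤ
val (false , a) = + suc (toℕ a)
val (true  , a) = - (+ suc (toℕ a))

idx : ∀ {n} → Fin n → ℕ
idx a = suc (toℕ a)

χneg : ∀ {n} → SFin n → ℤ
χneg (false , _) = + 0
χneg (true  , _) = + 1

_≟S_ : ∀ {n} (x y : SFin n) → Dec (x ≡ y)
_≟S_ = ≡-dec _≟B_ _≟F_

record B (n : ℕ) : Set where
  field
    perm : SFin n ↔ SFin n
    odd  : ∀ x → Inverse.to perm (negate x) ≡ negate (Inverse.to perm x)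

app : ∀ {n} → B n → SFin n → SFin n
app σ = Inverse.to (B.perm σ)

appInv : ∀ {n} → B n → SFin n → SFin n
appInv σ = Inverse.from (B.perm σ)

iter : ∀ {A : Set} → ℕ → (A → A) → A → A
iter zero    f x = x
iter (suc k) f x = f (iter k f x)

powInv : ∀ {n} → B n → ℕ → SFin n → SFin n
powInv σ k = iter k (appInv σ)

IsBCode : ∀ {n} → B n → (Fin n → SFin n) → Set
IsBCode {n} σ b = ∀ (i : Fin n) → ∃[ k ]
  ( 1 ℕ.≤ k
  × powInv σ k (pos i) ≡ b i
  × absℕ (b i) ℕ.≤ idx i
  × (∀ j → 1 ℕ.≤ j → j ℕ.< k → idx i ℕ.< absℕ (powInv σ j (pos i))))

maxCount : ∀ {n} → (Fin n → SFin n) → ℕ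
maxCount {n} b = length (filter (λ i → b i ≟S pos i) (allFin n))

data Refl (n : ℕ) : Set where
  tpos : (i j : Fin n) → i Fin.< j → Refl n   -- (i , j)
  tneg : (i j : Fin n) → i Fin.< j → Refl n   -- (-i , j)
  tbar : (j : Fin n) → Refl n                 -- (-j , j)

act : ∀ {n} → Refl n → SFin n → SFin n
act (tpos i j _) (s , a) with a ≟F i | a ≟F j
... | yes _ | _     = (s , j)
... | no _  | yes _ = (s , i)
... | no _  | no _  = (s , a)
act (tneg i j _) (s , a) with a ≟F i | a ≟F j
... | yes _ | _     = (not s , j)
... | no _  | yes _ = (not s , i)
... | no _  | no _  = (s , a)
act (tbar j) (s , a) with a ≟F j
... | yes _ = (not s , a)
... | no _  = (s , a)

prod : ∀ {n} → List (Refl n) → SFin n → SFin n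
prod []       x = x
prod (t ∷ ts) x = act t (prod ts x)

jOf : ∀ {n} → Refl n → ℕ
jOf (tpos _ j _) = idx j
jOf (tneg _ j _) = idx j
jOf (tbar j)     = idx j

weight : ∀ {n} → Refl n → ℤ
weight (tpos i j _) = (+ idx j) ℤ.- (+ idx i) ℤ.- (+ 0)
weight (tneg i j _) = (+ idx j) ℤ.- (- (+ idx i)) ℤ.- (+ 1)
weight (tbar j)     = (+ idx j) ℤ.- (- (+ idx j)) ℤ.- (+ 1)

sumℤ : List ℤ → ℤ
sumℤ = foldr ℤ._+_ (+ 0)

IsSorFactorization : ∀ {n} → B n → List (Refl n) → Set
IsSorFactorization σ ts =
  Linked (λ s t → jOf s ℕ.< jOf t) ts × (∀ x → prod ts x ≡ app σ x)

sorOf : ∀ {n} → List (Refl n) → ℤ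
sorOf ts = sumℤ (map weight ts)

IsReflFactorization : ∀ {n} → B n → List (Refl n) → Set
IsReflFactorization σ ts = ∀ x → prod ts x ≡ app σ x

IsReflLength : ∀ {n} → B n → ℕ → Set
IsReflLength σ m =
  (∃[ ts ] (IsReflFactorization σ ts × length ts ≡ m))
  × (∀ ts → IsReflFactorization σ ts → m ℕ.≤ length ts)

codeSum : ∀ {n} → (Fin n → SFin n) → ℤ
codeSum {n} b = sumℤ (map (λ i → (+ idx i) ℤ.- val (b i) ℤ.- χneg (b i)) (allFin n))

-- Write g = σ⁻¹; b_i is where the g-trajectory of i first returns to levels ≤ i.  In the sorted
-- factorization the last reflection t has the largest index j, and σ fixes every point above j,
-- so b_j = g(j) = t(j) and j - b_j - χ(b_j < 0) is the weight of t.  Moreover t ∘ g fixes j and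
-- has the code of g with b_j replaced by j, because it follows the trajectories of g below j
-- except that it skips ±j.  Peeling reflections off from the top gives the sor_B formula, and run
-- backwards (choosing t with t(j) = b_j whenever b_j ≠ j) it builds a factorization of length
-- n - |Max b|.  For minimality, i ∈ Max b exactly when the orbit of i stays at levels ≥ i and
-- avoids -i.  One more reflection t in a factorization destroys at most one such i: if t touched
-- the orbits of two of them, i₁ < i₂, it would glue them into a set on which the new permutation
-- stays at levels ≥ i₁ and never reaches -i₁, so i₁ would survive.  Hence n ≤ |Max b| + length.
module Submission where

open import Defs
open import Data.Bool using (Bool; true; false; not; if_then_else_)
open import Data.Bool.Properties using (not-involutive)
open import Data.Nat as ℕ using (ℕ; zero; suc; _+_; _*_; _∸_; _≤_; _<_; z≤n; s≤s)
import Data.Nat.Properties as ℕP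
open import Data.Nat.DivMod using (_%_; _/_; m≡m%n+[m/n]*n; m%n<n)
open import Data.Fin as Fin using (Fin; toℕ; fromℕ<; join; splitAt) renaming (zero to fzero; suc to fsuc)
open import Data.Fin.Properties
  using (toℕ-injective; <⇒≢; ≤∧≢⇒<; punchInᵢ≢i; suc-injective; toℕ<n; toℕ-fromℕ<; splitAt-join; pigeonhole)
  renaming (_≟_ to _≟F_)
open import Data.Product using (_×_; _,_; proj₁; proj₂; Σ; ∃-syntax)
open import Data.Sum using (_⊎_; inj₁; inj₂)
open import Data.Empty using (⊥; ⊥-elim)
open import Data.List using (List; []; _∷_; _∷ʳ_; map; filter; length; tabulate; allFin)
open import Data.List.Properties using (map-tabulate; length-++)
open import Data.List.Relation.Unary.All as All using (All; []; _∷_)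
open import Data.List.Relation.Unary.Linked using (Linked; []; [-]; _∷_)
open import Data.List.Reverse using (Reverse; []; _∶_∶ʳ_; reverseView)
open import Relation.Binary.Core using (Rel)
open import Relation.Binary.Definitions using (Transitive; tri<; tri≈; tri>)
open import Data.Vec.Functional using (updateAt)
open import Data.Vec.Functional.Properties using (updateAt-updates; updateAt-minimal)
open import Relation.Nullary using (¬_; Dec; yes; no; does)
open import Relation.Nullary.Decidable using (dec-true; dec-false; decidable-stable)
open import Data.Integer as ℤ using (ℤ; +_)
import Data.Integer.Properties as ℤP
open import Data.Integer.Tactic.RingSolver using (solve-∀)
open import Algebra.Properties.CommutativeMonoid.Sum ℤP.+-0-commutativeMonoid
  using (sum; sum-remove; sum-cong-≗; sum-replicate-zero)
open import Relation.Binary.PropositionalEquality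
open import Function using (_∘_; id; const)
open import Function.Bundles using (Inverse)
open import Function.Definitions using (Injective)

neg : ∀ {n} → Fin n → SFin n
neg a = (true , a)

absFin : ∀ {n} → SFin n → Fin n
absFin = proj₂

same-absFin : ∀ {n} (x y : SFin n) → absFin x ≡ absFin y → y ≡ x ⊎ y ≡ negate x
same-absFin (false , a) (false , .a) refl = inj₁ refl
same-absFin (false , a) (true  , .a) refl = inj₂ refl
same-absFin (true  , a) (false , .a) refl = inj₂ refl
same-absFin (true  , a) (true  , .a) refl = inj₁ refl

same-level : ∀ {n} {i j : Fin n} → idx i ≤ idx j → idx j ≤ idx i → i ≡ j
same-level i≤j j≤i = toℕ-injective (ℕP.suc-injective (ℕP.≤-antisym i≤j j≤i))

negate-involutive : ∀ {n} (x : SFin n) → negate (negate x) ≡ x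
negate-involutive (s , a) = cong (_, a) (not-involutive s)

inverse-injective : ∀ {A B : Set} {f : B → A} {g : A → B} → f ∘ g ≗ id → Injective _≡_ _≡_ g
inverse-injective {f = f} f∘g {x} {y} gx≡gy = trans (sym (f∘g x)) (trans (cong f gx≡gy) (f∘g y))

inverse-of : ∀ {A B : Set} {f : A → B} {g : B → A} → g ∘ f ≗ id → ∀ {x y} → f x ≡ y → g y ≡ x
inverse-of g∘f {x} refl = g∘f x

Odd : ∀ {n} → (SFin n → SFin n) → Set
Odd f = ∀ x → f (negate x) ≡ negate (f x)

inverse-odd : ∀ {n} {f g : SFin n → SFin n} → f ∘ g ≗ id → g ∘ f ≗ id → Odd f → Odd g
inverse-odd {f = f} {g} f∘g g∘f f-odd x = begin
  g (negate x)             ≡⟨ cong (g ∘ negate) (sym (f∘g x)) ⟩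
  g (negate (f (g x)))     ≡⟨ cong g (sym (f-odd (g x))) ⟩
  g (f (negate (g x)))     ≡⟨ g∘f (negate (g x)) ⟩
  negate (g x)             ∎
  where open ≡-Reasoning

top bottom : ∀ {n} → Refl n → Fin n
top (tpos _ j _) = j
top (tneg _ j _) = j
top (tbar j)     = j
bottom (tpos i _ _) = i
bottom (tneg i _ _) = i
bottom (tbar j)     = j

jOf≡idx-top : ∀ {n} (t : Refl n) → jOf t ≡ idx (top t)
jOf≡idx-top (tpos _ _ _) = refl
jOf≡idx-top (tneg _ _ _) = refl
jOf≡idx-top (tbar _)     = refl

module _ {n : ℕ} where

  act-tpos-bottom : (a c : Fin n) (p : a Fin.< c) (s : Bool) → act (tpos a c p) (s , a) ≡ (s , c)
  act-tpos-bottom a c p s with a ≟F a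
  ... | yes _ = refl
  ... | no a≢a = ⊥-elim (a≢a refl)

  act-tpos-top : (a c : Fin n) (p : a Fin.< c) (s : Bool) → act (tpos a c p) (s , c) ≡ (s , a)
  act-tpos-top a c p s with c ≟F a | c ≟F c
  ... | yes c≡a | _     = ⊥-elim (<⇒≢ p (sym c≡a))
  ... | no _    | yes _ = refl
  ... | no _    | no c≢c = ⊥-elim (c≢c refl)

  act-tpos-other : (a c : Fin n) (p : a Fin.< c) (s : Bool) {y : Fin n} →
                   y ≢ a → y ≢ c → act (tpos a c p) (s , y) ≡ (s , y)
  act-tpos-other a c p s {y} y≢a y≢c with y ≟F a | y ≟F c
  ... | yes y≡a | _       = ⊥-elim (y≢a y≡a)
  ... | no _    | yes y≡c = ⊥-elim (y≢c y≡c)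
  ... | no _    | no _    = refl

  act-tneg-bottom : (a c : Fin n) (p : a Fin.< c) (s : Bool) → act (tneg a c p) (s , a) ≡ (not s , c)
  act-tneg-bottom a c p s with a ≟F a
  ... | yes _ = refl
  ... | no a≢a = ⊥-elim (a≢a refl)

  act-tneg-top : (a c : Fin n) (p : a Fin.< c) (s : Bool) → act (tneg a c p) (s , c) ≡ (not s , a)
  act-tneg-top a c p s with c ≟F a | c ≟F c
  ... | yes c≡a | _     = ⊥-elim (<⇒≢ p (sym c≡a))
  ... | no _    | yes _ = refl
  ... | no _    | no c≢c = ⊥-elim (c≢c refl)

  act-tneg-other : (a c : Fin n) (p : a Fin.< c) (s : Bool) {y : Fin n} →
                   y ≢ a → y ≢ c → act (tneg a c p) (s , y) ≡ (s , y)
  act-tneg-other a c p s {y} y≢a y≢c with y ≟F a | y ≟F c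
  ... | yes y≡a | _       = ⊥-elim (y≢a y≡a)
  ... | no _    | yes y≡c = ⊥-elim (y≢c y≡c)
  ... | no _    | no _    = refl

  act-tbar-top : (j : Fin n) (s : Bool) → act (tbar j) (s , j) ≡ (not s , j)
  act-tbar-top j s with j ≟F j
  ... | yes _ = refl
  ... | no j≢j = ⊥-elim (j≢j refl)

  act-tbar-other : (j : Fin n) (s : Bool) {y : Fin n} → y ≢ j → act (tbar j) (s , y) ≡ (s , y)
  act-tbar-other j s {y} y≢j with y ≟F j
  ... | yes y≡j = ⊥-elim (y≢j y≡j)
  ... | no _    = refl

  act-involutive : (t : Refl n) (x : SFin n) → act t (act t x) ≡ x
  act-involutive (tpos a c p) (s , y) with y ≟F a | y ≟F c
  ... | yes refl | _        = act-tpos-top y c p s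
  ... | no _     | yes refl = act-tpos-bottom a y p s
  ... | no y≢a   | no y≢c   = act-tpos-other a c p s y≢a y≢c
  act-involutive (tneg a c p) (s , y) with y ≟F a | y ≟F c
  ... | yes refl | _        = trans (act-tneg-top y c p (not s)) (cong (_, y) (not-involutive s))
  ... | no _     | yes refl = trans (act-tneg-bottom a y p (not s)) (cong (_, y) (not-involutive s))
  ... | no y≢a   | no y≢c   = act-tneg-other a c p s y≢a y≢c
  act-involutive (tbar j) (s , y) with y ≟F j
  ... | yes refl = trans (act-tbar-top y (not s)) (cong (_, y) (not-involutive s))
  ... | no y≢j   = act-tbar-other j s y≢j

  act-negate : (t : Refl n) (x : SFin n) → act t (negate x) ≡ negate (act t x)
  act-negate (tpos a c p) (s , y) with y ≟F a | y ≟F c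
  ... | yes _ | _     = refl
  ... | no _  | yes _ = refl
  ... | no _  | no _  = refl
  act-negate (tneg a c p) (s , y) with y ≟F a | y ≟F c
  ... | yes _ | _     = refl
  ... | no _  | yes _ = refl
  ... | no _  | no _  = refl
  act-negate (tbar j) (s , y) with y ≟F j
  ... | yes _ = refl
  ... | no _  = refl

  act-fixes-above : (t : Refl n) (x : SFin n) → idx (top t) < absℕ x → act t x ≡ x
  act-fixes-above (tpos a c p) (s , y) (s≤s c<y) =
    act-tpos-other a c p s (λ y≡a → <⇒≢ (ℕP.<-trans p c<y) (sym y≡a)) (λ y≡c → <⇒≢ c<y (sym y≡c))
  act-fixes-above (tneg a c p) (s , y) (s≤s c<y) =
    act-tneg-other a c p s (λ y≡a → <⇒≢ (ℕP.<-trans p c<y) (sym y≡a)) (λ y≡c → <⇒≢ c<y (sym y≡c))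
  act-fixes-above (tbar j) (s , y) (s≤s j<y) = act-tbar-other j s (λ y≡j → <⇒≢ j<y (sym y≡j))

  absℕ-act-top≤ : (t : Refl n) → absℕ (act t (pos (top t))) ≤ idx (top t)
  absℕ-act-top≤ (tpos a c p) rewrite act-tpos-top a c p false = s≤s (ℕP.<⇒≤ p)
  absℕ-act-top≤ (tneg a c p) rewrite act-tneg-top a c p false = s≤s (ℕP.<⇒≤ p)
  absℕ-act-top≤ (tbar j)     rewrite act-tbar-top j false     = ℕP.≤-refl

  weight≡ : (t : Refl n) → let y = act t (pos (top t)) in
            weight t ≡ (+ idx (top t)) ℤ.- val y ℤ.- χneg y
  weight≡ (tpos a c p) rewrite act-tpos-top a c p false = refl
  weight≡ (tneg a c p) rewrite act-tneg-top a c p false = refl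
  weight≡ (tbar j)     rewrite act-tbar-top j false     = refl

  act-fixes-off-top : (t : Refl n) (y : SFin n) → absFin y ≢ top t →
              y ≢ act t (pos (top t)) → y ≢ act t (neg (top t)) → act t y ≡ y
  act-fixes-off-top (tpos a c p) (s , z) z≢c y≢ y≢' with toℕ z ℕ.≟ toℕ a
  ... | no z≢a = act-tpos-other a c p s (z≢a ∘ cong toℕ) z≢c
  act-fixes-off-top (tpos a c p) (false , z) z≢c y≢ y≢' | yes z≡a with refl ← toℕ-injective z≡a =
    ⊥-elim (y≢ (sym (act-tpos-top z c p false)))
  act-fixes-off-top (tpos a c p) (true , z) z≢c y≢ y≢' | yes z≡a with refl ← toℕ-injective z≡a =
    ⊥-elim (y≢' (sym (act-tpos-top z c p true)))
  act-fixes-off-top (tneg a c p) (s , z) z≢c y≢ y≢' with toℕ z ℕ.≟ toℕ a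
  ... | no z≢a = act-tneg-other a c p s (z≢a ∘ cong toℕ) z≢c
  act-fixes-off-top (tneg a c p) (true , z) z≢c y≢ y≢' | yes z≡a with refl ← toℕ-injective z≡a =
    ⊥-elim (y≢ (sym (act-tneg-top z c p false)))
  act-fixes-off-top (tneg a c p) (false , z) z≢c y≢ y≢' | yes z≡a with refl ← toℕ-injective z≡a =
    ⊥-elim (y≢' (sym (act-tneg-top z c p true)))
  act-fixes-off-top (tbar j) (s , z) z≢j _ _ = act-tbar-other j s z≢j

  reflection-sending-top : (j : Fin n) (y : SFin n) → absℕ y ≤ idx j → y ≢ pos j →
                           Σ (Refl n) λ t → top t ≡ j × act t (pos j) ≡ y
  reflection-sending-top j (s , a) (s≤s a≤j) y≢j with a ≟F j
  reflection-sending-top j (true  , a) _ _   | yes refl = tbar a , refl , act-tbar-top a false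
  reflection-sending-top j (false , a) _ y≢j | yes refl = ⊥-elim (y≢j refl)
  reflection-sending-top j (false , a) (s≤s a≤j) _ | no a≢j =
    tpos a j a<j , refl , act-tpos-top a j a<j false
    where a<j = ≤∧≢⇒< a≤j a≢j
  reflection-sending-top j (true , a) (s≤s a≤j) _ | no a≢j =
    tneg a j a<j , refl , act-tneg-top a j a<j false
    where a<j = ≤∧≢⇒< a≤j a≢j

  act-moves-bottom-top : (t : Refl n) (x : SFin n) → act t x ≢ x →
    (absFin x ≡ bottom t × absFin (act t x) ≡ top t) ⊎ (absFin x ≡ top t × absFin (act t x) ≡ bottom t)
  act-moves-bottom-top (tpos a c p) (s , y) moved with y ≟F a | y ≟F c
  ... | yes y≡a | _       = inj₁ (y≡a , refl)
  ... | no _    | yes y≡c = inj₂ (y≡c , refl)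
  ... | no _    | no _    = ⊥-elim (moved refl)
  act-moves-bottom-top (tneg a c p) (s , y) moved with y ≟F a | y ≟F c
  ... | yes y≡a | _       = inj₁ (y≡a , refl)
  ... | no _    | yes y≡c = inj₂ (y≡c , refl)
  ... | no _    | no _    = ⊥-elim (moved refl)
  act-moves-bottom-top (tbar j) (s , y) moved with y ≟F j
  ... | yes y≡j = inj₁ (y≡j , y≡j)
  ... | no _    = ⊥-elim (moved refl)

  moved-same-absFin : (t : Refl n) (z x : SFin n) → act t z ≢ z → act t x ≢ x →
                      absFin z ≢ absFin (act t x) → absFin z ≡ absFin x
  moved-same-absFin t z x z-moved x-moved z≢tx
    with act-moves-bottom-top t z z-moved | act-moves-bottom-top t x x-moved
  ... | inj₁ (z≡b , _) | inj₁ (x≡b , _)  = trans z≡b (sym x≡b)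
  ... | inj₁ (z≡b , _) | inj₂ (_ , tx≡b) = ⊥-elim (z≢tx (trans z≡b (sym tx≡b)))
  ... | inj₂ (z≡t , _) | inj₁ (_ , tx≡t) = ⊥-elim (z≢tx (trans z≡t (sym tx≡t)))
  ... | inj₂ (z≡t , _) | inj₂ (x≡t , _)  = trans z≡t (sym x≡t)

iter-sucʳ : ∀ {A : Set} k (f : A → A) x → iter (suc k) f x ≡ iter k f (f x)
iter-sucʳ zero    f x = refl
iter-sucʳ (suc k) f x = cong f (iter-sucʳ k f x)

iter-+ : ∀ {A : Set} a b (f : A → A) x → iter (a + b) f x ≡ iter a f (iter b f x)
iter-+ zero    b f x = refl
iter-+ (suc a) b f x = cong f (iter-+ a b f x)

module _ {n : ℕ} where

  data FirstEntry (g : SFin n → SFin n) (i : ℕ) : SFin n → SFin n → Set where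
    now   : ∀ {x} → absℕ (g x) ≤ i → FirstEntry g i x (g x)
    later : ∀ {x y} → i < absℕ (g x) → FirstEntry g i (g x) y → FirstEntry g i x y

  IsCode : (SFin n → SFin n) → (Fin n → SFin n) → Set
  IsCode g b = ∀ i → FirstEntry g (idx i) (pos i) (b i)

  FirstEntry-unique : ∀ {g i x y y′} → FirstEntry g i x y → FirstEntry g i x y′ → y ≡ y′
  FirstEntry-unique (now _)      (now _)      = refl
  FirstEntry-unique (now ≤i)     (later >i _) = ⊥-elim (ℕP.<⇒≱ >i ≤i)
  FirstEntry-unique (later >i _) (now ≤i)     = ⊥-elim (ℕP.<⇒≱ >i ≤i)
  FirstEntry-unique (later _ e)  (later _ e′) = FirstEntry-unique e e′

  now≡ : ∀ {g i x y} → g x ≡ y → absℕ y ≤ i → FirstEntry g i x y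
  now≡ refl = now

  later≡ : ∀ {g i x y z} → g x ≡ z → i < absℕ z → FirstEntry g i z y → FirstEntry g i x y
  later≡ refl = later

  iter⇒FirstEntry : ∀ {g i} k x → absℕ (iter (suc k) g x) ≤ i →
                    (∀ j → 1 ≤ j → j ≤ k → i < absℕ (iter j g x)) → FirstEntry g i x (iter (suc k) g x)
  iter⇒FirstEntry zero x ≤i _ = now ≤i
  iter⇒FirstEntry {g} {i} (suc k) x ≤i >i = later (>i 1 ℕP.≤-refl (s≤s z≤n))
    (subst (FirstEntry g i (g x)) (sym (iter-sucʳ (suc k) g x))
      (iter⇒FirstEntry k (g x) (subst (λ z → absℕ z ≤ i) (iter-sucʳ (suc k) g x) ≤i)
        (λ j 1≤j j≤k → subst (λ z → i < absℕ z) (iter-sucʳ j g x) (>i (suc j) (s≤s z≤n) (s≤s j≤k)))))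

  FirstEntry⇒iter : ∀ {g i x y} → FirstEntry g i x y →
    ∃[ K ] (1 ≤ K × iter K g x ≡ y × (∀ j → 1 ≤ j → j < K → i < absℕ (iter j g x)))
  FirstEntry⇒iter (now _) = 1 , s≤s z≤n , refl , λ { j 1≤j (s≤s j≤0) → ⊥-elim (ℕP.<⇒≱ 1≤j j≤0) }
  FirstEntry⇒iter {g} {i} {x} (later >i e) with K , 1≤K , gᴷ≡y , >i′ ← FirstEntry⇒iter e =
    suc K , s≤s z≤n , trans (iter-sucʳ K g x) gᴷ≡y , λ
      { (suc zero) _ _ → >i
      ; (suc (suc j)) _ (s≤s j<K) →
          subst (λ z → i < absℕ z) (sym (iter-sucʳ (suc j) g x)) (>i′ (suc j) (s≤s z≤n) j<K) }

  IsBCode⇒IsCode : (σ : B n) (b : Fin n → SFin n) → IsBCode σ b → IsCode (appInv σ) b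
  IsBCode⇒IsCode σ b isB i with isB i
  ... | suc k , _ , σ⁻ᵏ≡b , ≤i , >i = subst (FirstEntry (appInv σ) (idx i) (pos i)) σ⁻ᵏ≡b
    (iter⇒FirstEntry k (pos i) (subst (λ z → absℕ z ≤ idx i) (sym σ⁻ᵏ≡b) ≤i)
      (λ j 1≤j j≤k → >i j 1≤j (s≤s j≤k)))

  IsCode-id⇒all-max : ∀ {g b} → g ≗ id → IsCode g b → ∀ i → b i ≡ pos i
  IsCode-id⇒all-max g≗id code i = sym (FirstEntry-unique (now≡ (g≗id (pos i)) ℕP.≤-refl) (code i))

  withMaxAt : (Fin n → SFin n) → Fin n → Fin n → SFin n
  withMaxAt b j = updateAt b j (const (pos j))

module _ {n : ℕ} where

  prod-∷ʳ : (ts : List (Refl n)) (t : Refl n) (x : SFin n) → prod (ts ∷ʳ t) x ≡ prod ts (act t x)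
  prod-∷ʳ []       t x = refl
  prod-∷ʳ (s ∷ ts) t x = cong (act s) (prod-∷ʳ ts t x)

  prod-fixes-above : (ts : List (Refl n)) (x : SFin n) → All (λ s → idx (top s) < absℕ x) ts → prod ts x ≡ x
  prod-fixes-above []       x []       = refl
  prod-fixes-above (s ∷ ts) x (p ∷ ps) rewrite prod-fixes-above ts x ps = act-fixes-above s x p

  prod-odd : (ts : List (Refl n)) → Odd (prod ts)
  prod-odd []       x = refl
  prod-odd (s ∷ ts) x rewrite prod-odd ts x = act-negate s (prod ts x)

  -- Peeling off the top reflection

  module PeelTop (f g : SFin n → SFin n) (f∘g : f ∘ g ≗ id) (g∘f : g ∘ f ≗ id) (f-odd : Odd f)
                 (t : Refl n) (f-fixes-above : ∀ x → idx (top t) < absℕ x → f x ≡ x)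
                 (f-top : f (act t (pos (top t))) ≡ pos (top t)) where

    private
      j = top t

      g-injective : ∀ {x y} → g x ≡ g y → x ≡ y
      g-injective = inverse-injective {f = f} {g = g} f∘g

      g-odd : Odd g
      g-odd = inverse-odd {f = f} {g = g} f∘g g∘f f-odd

      g-fixes-above : ∀ x → idx j < absℕ x → g x ≡ x
      g-fixes-above x j<x = inverse-of {f = f} {g = g} g∘f (f-fixes-above x j<x)

      g-top : g (pos j) ≡ act t (pos j)
      g-top = inverse-of {f = f} {g = g} g∘f f-top

      g-neg-top : g (neg j) ≡ act t (neg j)
      g-neg-top = trans (g-odd (pos j)) (trans (cong negate g-top) (sym (act-negate t (pos j))))

      g≡t-over-top : ∀ x → absFin x ≡ j → g x ≡ act t x
      g≡t-over-top x |x|≡j with same-absFin (pos j) x (sym |x|≡j)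
      ... | inj₁ refl = g-top
      ... | inj₂ refl = g-neg-top

    g′ : SFin n → SFin n
    g′ = act t ∘ g

    private
      g′≡g-off-top : ∀ x → absFin x ≢ j → absFin (g x) ≢ j → g′ x ≡ g x
      g′≡g-off-top x |x|≢j |gx|≢j = act-fixes-off-top t (g x) |gx|≢j
        (λ e → |x|≢j (cong absFin (g-injective (trans e (sym g-top)))))
        (λ e → |x|≢j (cong absFin (g-injective (trans e (sym g-neg-top)))))

      g-leaves-top : ∀ x → absFin x ≢ j → absFin (g x) ≡ j → absFin (g (g x)) ≢ j
      g-leaves-top x |x|≢j |gx|≡j |ggx|≡j with same-absFin (g x) (g (g x)) (trans |gx|≡j (sym |ggx|≡j))
      ... | inj₁ ggx≡gx  = |x|≢j (trans (cong absFin (sym (g-injective ggx≡gx))) |gx|≡j)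
      ... | inj₂ ggx≡-gx =
        |x|≢j (trans (cong absFin (sym (g-injective (trans ggx≡-gx (sym (g-odd x)))))) |gx|≡j)

      below-top : ∀ {i} z → absℕ z ≤ i → i < idx j → absFin z ≢ j
      below-top z ≤i i<j refl = ℕP.<-irrefl refl (ℕP.≤-<-trans ≤i i<j)

    -- Below level j the trajectories of t ∘ g are those of g with the points ±j skipped.
    FirstEntry-peel : ∀ {i x y} → i < idx j → FirstEntry g i x y → absFin x ≢ j → FirstEntry g′ i x y
    FirstEntry-peel {x = x} i<j (now ≤i) |x|≢j =
      now≡ (g′≡g-off-top x |x|≢j (below-top (g x) ≤i i<j)) ≤i
    FirstEntry-peel {x = x} i<j (later >i e) |x|≢j with absFin (g x) ≟F j
    ... | no |gx|≢j = later≡ (g′≡g-off-top x |x|≢j |gx|≢j) >i (FirstEntry-peel i<j e |gx|≢j)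
    ... | yes |gx|≡j with e
    ...   | now ≤i′        = now≡ (sym (g≡t-over-top (g x) |gx|≡j)) ≤i′
    ...   | later >i′ e′   = later≡ (sym (g≡t-over-top (g x) |gx|≡j)) >i′
                               (FirstEntry-peel i<j e′ (g-leaves-top x |x|≢j |gx|≡j))

    IsCode⇒top : ∀ {b} → IsCode g b → b j ≡ act t (pos j)
    IsCode⇒top code = sym (FirstEntry-unique (now≡ g-top (absℕ-act-top≤ t)) (code j))

    IsCode-peel : ∀ {b} → IsCode g b → IsCode g′ (withMaxAt b j)
    IsCode-peel {b} code i with ℕP.<-cmp (toℕ i) (toℕ j)
    ... | tri< i<j _ _ = subst (FirstEntry g′ (idx i) (pos i)) (sym (updateAt-minimal i j b i≢j))
                           (FirstEntry-peel (s≤s i<j) (code i) i≢j)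
      where i≢j = <⇒≢ i<j
    ... | tri≈ _ i≡j _ with refl ← toℕ-injective i≡j =
      subst (FirstEntry g′ (idx i) (pos i)) (sym (updateAt-updates i b))
        (now≡ (trans (cong (act t) g-top) (act-involutive t (pos j))) ℕP.≤-refl)
    ... | tri> _ _ i>j = subst (FirstEntry g′ (idx i) (pos i)) (sym (trans (updateAt-minimal i j b i≢j) b≡i))
                           (now≡ g′i≡i ℕP.≤-refl)
      where
        i≢j = <⇒≢ i>j ∘ sym
        gi≡i = g-fixes-above (pos i) (s≤s i>j)
        b≡i = sym (FirstEntry-unique (now≡ gi≡i ℕP.≤-refl) (code i))
        g′i≡i = trans (cong (act t) gi≡i) (act-fixes-above t (pos i) (s≤s i>j))

sumℤ-map-allFin : ∀ {n} (F : Fin n → ℤ) → sumℤ (map F (allFin n)) ≡ sum F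
sumℤ-map-allFin {n} F = trans (cong sumℤ (map-tabulate id F)) (sumℤ-tabulate F)
  where
    sumℤ-tabulate : ∀ {m} (G : Fin m → ℤ) → sumℤ (tabulate G) ≡ sum G
    sumℤ-tabulate {zero}  G = refl
    sumℤ-tabulate {suc m} G = cong (λ s → G fzero ℤ.+ s) (sumℤ-tabulate (G ∘ fsuc))

sum-exchange : ∀ {n} (F G : Fin n → ℤ) (j : Fin n) → (∀ i → i ≢ j → F i ≡ G i) →
               sum F ℤ.+ G j ≡ sum G ℤ.+ F j
sum-exchange {suc n} F G j F≡G = begin
  sum F ℤ.+ G j                ≡⟨ cong (ℤ._+ G j) (sum-remove {i = j} F) ⟩
  F j ℤ.+ rest F ℤ.+ G j       ≡⟨ swap (F j) (rest F) (G j) ⟩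
  G j ℤ.+ rest F ℤ.+ F j       ≡⟨ cong (λ r → G j ℤ.+ r ℤ.+ F j) (sum-cong-≗ off-j) ⟩
  G j ℤ.+ rest G ℤ.+ F j       ≡⟨ cong (ℤ._+ F j) (sym (sum-remove {i = j} G)) ⟩
  sum G ℤ.+ F j                ∎
  where
    open ≡-Reasoning
    rest : (Fin (suc n) → ℤ) → ℤ
    rest H = sum (H ∘ Fin.punchIn j)
    off-j : ∀ k → F (Fin.punchIn j k) ≡ G (Fin.punchIn j k)
    off-j k = F≡G (Fin.punchIn j k) (punchInᵢ≢i j k)
    swap : ∀ a r b → a ℤ.+ r ℤ.+ b ≡ b ℤ.+ r ℤ.+ a
    swap = solve-∀

count : ∀ {n} → (Fin n → Bool) → ℕ
count {zero}  P = 0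
count {suc n} P = (if P fzero then 1 else 0) + count (P ∘ fsuc)

length-filter-tabulate : ∀ {n} {A : Set} {Q : A → Set} (Q? : ∀ a → Dec (Q a)) (h : Fin n → A) →
                         length (filter Q? (tabulate h)) ≡ count (λ i → does (Q? (h i)))
length-filter-tabulate {zero}  Q? h = refl
length-filter-tabulate {suc n} Q? h with does (Q? (h fzero))
... | true  = cong suc (length-filter-tabulate Q? (h ∘ fsuc))
... | false = length-filter-tabulate Q? (h ∘ fsuc)

count-all : ∀ {n} (P : Fin n → Bool) → (∀ i → P i ≡ true) → count P ≡ n
count-all {zero}  P all = refl
count-all {suc n} P all rewrite all fzero = cong suc (count-all (P ∘ fsuc) (all ∘ fsuc))

count-cong : ∀ {n} (P Q : Fin n → Bool) → (∀ i → P i ≡ Q i) → count P ≡ count Q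
count-cong {zero}  P Q P≡Q = refl
count-cong {suc n} P Q P≡Q rewrite P≡Q fzero = cong (λ m → (if Q fzero then 1 else 0) + m) (count-cong (P ∘ fsuc) (Q ∘ fsuc) (P≡Q ∘ fsuc))

count-insert : ∀ {n} (P Q : Fin n → Bool) (j : Fin n) → (∀ i → i ≢ j → P i ≡ Q i) →
               P j ≡ false → Q j ≡ true → count Q ≡ suc (count P)
count-insert {suc n} P Q fzero P≡Q Pj Qj rewrite Pj | Qj =
  cong suc (count-cong (Q ∘ fsuc) (P ∘ fsuc) (λ i → sym (P≡Q (fsuc i) λ ())))
count-insert {suc n} P Q (fsuc j) P≡Q Pj Qj rewrite P≡Q fzero (λ ()) =
  trans (cong (λ m → (if Q fzero then 1 else 0) + m) (count-insert (P ∘ fsuc) (Q ∘ fsuc) j (λ i i≢j → P≡Q (fsuc i) (i≢j ∘ suc-injective)) Pj Qj))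
        (ℕP.+-suc _ _)

count-mono : ∀ {n} (P Q : Fin n → Bool) → (∀ i → P i ≡ true → Q i ≡ true) → count P ≤ count Q
count-mono {zero}  P Q P⊆Q = z≤n
count-mono {suc n} P Q P⊆Q = ℕP.+-mono-≤ (head-mono (P fzero) (Q fzero) (P⊆Q fzero))
                                         (count-mono (P ∘ fsuc) (Q ∘ fsuc) (P⊆Q ∘ fsuc))
  where
    head-mono : ∀ a b → (a ≡ true → b ≡ true) → (if a then 1 else 0) ≤ (if b then 1 else 0)
    head-mono false b _   = z≤n
    head-mono true  b a⇒b rewrite a⇒b refl = ℕP.≤-refl

count≤count+1 : ∀ {n} (P Q : Fin n → Bool) →
                (∀ i₁ i₂ → i₁ ≢ i₂ → P i₁ ≡ true → Q i₁ ≡ false → P i₂ ≡ true → Q i₂ ≡ false → ⊥) →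
                count P ≤ count Q + 1
count≤count+1 {zero}  P Q _ = z≤n
count≤count+1 {suc n} P Q one with P fzero in P0 | Q fzero in Q0
... | true | false = subst (suc (count (P ∘ fsuc)) ≤_) (ℕP.+-comm 1 _) (s≤s (count-mono (P ∘ fsuc) (Q ∘ fsuc) P⊆Q))
  where
    P⊆Q : ∀ i → P (fsuc i) ≡ true → Q (fsuc i) ≡ true
    P⊆Q i Pi with Q (fsuc i) in Qi
    ... | true  = refl
    ... | false = ⊥-elim (one fzero (fsuc i) (λ ()) P0 Q0 Pi Qi)
... | false | q = ℕP.≤-trans (count≤count+1 (P ∘ fsuc) (Q ∘ fsuc) one′)
                             (ℕP.+-monoˡ-≤ 1 (ℕP.m≤n+m (count (Q ∘ fsuc)) (if q then 1 else 0)))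
  where one′ = λ i₁ i₂ i₁≢i₂ → one (fsuc i₁) (fsuc i₂) (i₁≢i₂ ∘ suc-injective)
... | true | true = s≤s (count≤count+1 (P ∘ fsuc) (Q ∘ fsuc) one′)
  where one′ = λ i₁ i₂ i₁≢i₂ → one (fsuc i₁) (fsuc i₂) (i₁≢i₂ ∘ suc-injective)

Linked-∷ʳ⁻ : ∀ {ℓ} {A : Set} {R : Rel A ℓ} → Transitive R → ∀ {xs x} →
             Linked R (xs ∷ʳ x) → Linked R xs × All (λ y → R y x) xs
Linked-∷ʳ⁻ R-trans {[]}         _           = [] , []
Linked-∷ʳ⁻ R-trans {y ∷ []}     (Ryx ∷ _)   = [-] , Ryx ∷ []
Linked-∷ʳ⁻ R-trans {y ∷ z ∷ xs} {x} (Ryz ∷ lnk) with Linked-∷ʳ⁻ R-trans {z ∷ xs} {x} lnk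
... | lnk′ , Rzx ∷ Rxs = Ryz ∷ lnk′ , R-trans Ryz Rzx ∷ Rzx ∷ Rxs

-- The sor_B formula

sorOf-∷ʳ : ∀ {n} (ts : List (Refl n)) (t : Refl n) → sorOf (ts ∷ʳ t) ≡ sorOf ts ℤ.+ weight t
sorOf-∷ʳ []       t = trans (ℤP.+-identityʳ (weight t)) (sym (ℤP.+-identityˡ (weight t)))
sorOf-∷ʳ (s ∷ ts) t = trans (cong (λ w → weight s ℤ.+ w) (sorOf-∷ʳ ts t)) (sym (ℤP.+-assoc (weight s) (sorOf ts) (weight t)))

_<ʲ_ : ∀ {n} → Refl n → Refl n → Set
s <ʲ t = jOf s < jOf t

module _ {n : ℕ} where

  gap : Fin n → SFin n → ℤ
  gap i y = (+ idx i) ℤ.- val y ℤ.- χneg y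

  codeTerm : (Fin n → SFin n) → Fin n → ℤ
  codeTerm b i = gap i (b i)

  codeTerm-max : ∀ b i → b i ≡ pos i → codeTerm b i ≡ + 0
  codeTerm-max b i b≡i rewrite b≡i = cong (ℤ._- + 0) (ℤP.+-inverseʳ (+ idx i))

  module SortedBelow (ts : List (Refl n)) (t : Refl n) (sorted-below : All (_<ʲ t) ts) where

    private
      below : All (λ s → idx (top s) < idx (top t)) ts
      below = All.map (λ {s} → subst₂ _<_ (jOf≡idx-top s) (jOf≡idx-top t)) sorted-below

    prod-∷ʳ-fixes-above : ∀ x → idx (top t) < absℕ x → prod (ts ∷ʳ t) x ≡ x
    prod-∷ʳ-fixes-above x t<x = begin
      prod (ts ∷ʳ t) x   ≡⟨ prod-∷ʳ ts t x ⟩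
      prod ts (act t x)  ≡⟨ cong (prod ts) (act-fixes-above t x t<x) ⟩
      prod ts x          ≡⟨ prod-fixes-above ts x (All.map (λ s<t → ℕP.<-trans s<t t<x) below) ⟩
      x                  ∎
      where open ≡-Reasoning

    prod-∷ʳ-top : prod (ts ∷ʳ t) (act t (pos (top t))) ≡ pos (top t)
    prod-∷ʳ-top = begin
      prod (ts ∷ʳ t) (act t (pos (top t)))   ≡⟨ prod-∷ʳ ts t _ ⟩
      prod ts (act t (act t (pos (top t))))  ≡⟨ cong (prod ts) (act-involutive t _) ⟩
      prod ts (pos (top t))                  ≡⟨ prod-fixes-above ts _ below ⟩
      pos (top t)                            ∎
      where open ≡-Reasoning

  sorOf≡sum-codeTerm : ∀ {ts} → Reverse ts → Linked _<ʲ_ ts → ∀ {g} → prod ts ∘ g ≗ id → g ∘ prod ts ≗ id →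
                       ∀ {b} → IsCode g b → sorOf ts ≡ sum (codeTerm b)
  sorOf≡sum-codeTerm [] _ _ g≗id {b} code = sym (trans (sum-cong-≗ all-zero) (sum-replicate-zero n))
    where all-zero = λ i → codeTerm-max b i (IsCode-id⇒all-max g≗id code i)
  sorOf≡sum-codeTerm (xs ∶ rv ∶ʳ t) linked {g} prod∘g g∘prod {b} code = begin
    sorOf (xs ∷ʳ t)                        ≡⟨ sorOf-∷ʳ xs t ⟩
    sorOf xs ℤ.+ weight t                  ≡⟨ cong₂ ℤ._+_ ih (sym codeTerm-top) ⟩
    sum (codeTerm b′) ℤ.+ codeTerm b j     ≡⟨ sym (sum-exchange (codeTerm b) (codeTerm b′) j agree) ⟩
    sum (codeTerm b) ℤ.+ codeTerm b′ j     ≡⟨ cong (λ w → sum (codeTerm b) ℤ.+ w) (codeTerm-max b′ j (updateAt-updates j b)) ⟩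
    sum (codeTerm b) ℤ.+ + 0               ≡⟨ ℤP.+-identityʳ _ ⟩
    sum (codeTerm b)                       ∎
    where
      open ≡-Reasoning
      split : Linked _<ʲ_ xs × All (_<ʲ t) xs
      split = Linked-∷ʳ⁻ ℕP.<-trans linked
      open SortedBelow xs t (proj₂ split)
      j = top t
      b′ = withMaxAt b j
      f = prod (xs ∷ʳ t)
      open PeelTop f g prod∘g g∘prod (prod-odd (xs ∷ʳ t)) t prod-∷ʳ-fixes-above prod-∷ʳ-top
      prod∘g′ : prod xs ∘ g′ ≗ id
      prod∘g′ x = trans (sym (prod-∷ʳ xs t (g x))) (prod∘g x)
      g′∘prod : g′ ∘ prod xs ≗ id
      g′∘prod x = begin
        act t (g (prod xs x))                      ≡⟨ cong (act t ∘ g ∘ prod xs) (act-involutive t x) ⟨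
        act t (g (prod xs (act t (act t x))))      ≡⟨ cong (act t ∘ g) (prod-∷ʳ xs t (act t x)) ⟨
        act t (g (prod (xs ∷ʳ t) (act t x)))       ≡⟨ cong (act t) (g∘prod (act t x)) ⟩
        act t (act t x)                            ≡⟨ act-involutive t x ⟩
        x                                          ∎
      ih : sorOf xs ≡ sum (codeTerm b′)
      ih = sorOf≡sum-codeTerm rv (proj₁ split) prod∘g′ g′∘prod (IsCode-peel code)
      codeTerm-top : codeTerm b j ≡ weight t
      codeTerm-top = trans (cong (gap j) (IsCode⇒top code)) (sym (weight≡ t))
      agree : ∀ i → i ≢ j → codeTerm b i ≡ codeTerm b′ i
      agree i i≢j = cong (gap i) (sym (updateAt-minimal i j b i≢j))

-- A factorization of length n - |Max b|

module _ {n : ℕ} where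

  isMaxᵇ : (Fin n → SFin n) → Fin n → Bool
  isMaxᵇ b i = does (b i ≟S pos i)

  isMaxᵇ⇒≡ : ∀ b i → isMaxᵇ b i ≡ true → b i ≡ pos i
  isMaxᵇ⇒≡ b i isMaxᵇ-true with b i ≟S pos i
  ... | yes b≡i = b≡i

  ¬isMaxᵇ⇒≢ : ∀ b i → isMaxᵇ b i ≡ false → b i ≢ pos i
  ¬isMaxᵇ⇒≢ b i isMaxᵇ-false b≡i with () ← trans (sym (dec-true (b i ≟S pos i) b≡i)) isMaxᵇ-false

  count-withMaxAt : ∀ b j → b j ≢ pos j → count (isMaxᵇ (withMaxAt b j)) ≡ suc (count (isMaxᵇ b))
  count-withMaxAt b j bj≢j = count-insert (isMaxᵇ b) (isMaxᵇ (withMaxAt b j)) j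
    (λ i i≢j → cong (λ y → does (y ≟S pos i)) (sym (updateAt-minimal i j b i≢j)))
    (dec-false (b j ≟S pos j) bj≢j)
    (dec-true (withMaxAt b j j ≟S pos j) (updateAt-updates j b))

  absℕ≤n : (x : SFin n) → absℕ x ≤ n
  absℕ≤n (_ , a) = toℕ<n a

  fixes-level : ∀ {f : SFin n → SFin n} (j : Fin n) → Odd f → f (pos j) ≡ pos j →
                (∀ x → idx j < absℕ x → f x ≡ x) → ∀ x → toℕ j < absℕ x → f x ≡ x
  fixes-level j f-odd fj≡j fixes x j≤|x| with ℕP.m≤n⇒m<n∨m≡n j≤|x|
  ... | inj₁ j<|x| = fixes x j<|x|
  ... | inj₂ j≡|x| with same-absFin (pos j) x (toℕ-injective (ℕP.suc-injective j≡|x|))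
  ...   | inj₁ refl = fj≡j
  ...   | inj₂ refl = trans (f-odd (pos j)) (cong negate fj≡j)

  Factorizable : ℕ → Set
  Factorizable k = ∀ {f g} → f ∘ g ≗ id → g ∘ f ≗ id → Odd f → (∀ x → k < absℕ x → f x ≡ x) →
                   ∀ {b} → IsCode g b → ∃[ ts ] (prod ts ≗ f × length ts + count (isMaxᵇ b) ≡ n)

  factorizable-zero : Factorizable 0
  factorizable-zero {f} {g} f∘g g∘f _ fixes {b} code =
    [] , (λ x → sym (fixes x (s≤s z≤n))) , count-all (isMaxᵇ b) (λ i → dec-true (b i ≟S pos i) (b≡ i))
    where b≡ = IsCode-id⇒all-max (λ x → inverse-of {f = f} {g = g} g∘f (fixes x (s≤s z≤n))) code

  -- If g moves j, the reflection t with t(j) = g(j) = b_j is split off as the last factor.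
  factorizable-suc : ∀ (j : Fin n) → Factorizable (toℕ j) → Factorizable (idx j)
  factorizable-suc j rec {f} {g} f∘g g∘f f-odd fixes {b} code with g (pos j) ≟S pos j
  ... | yes gj≡j = rec f∘g g∘f f-odd (fixes-level j f-odd (inverse-of {f = g} {g = f} f∘g gj≡j) fixes) code
  ... | no gj≢j with reflection-sending-top j (g (pos j)) |gj|≤j gj≢j
    where
      |gj|≤j : absℕ (g (pos j)) ≤ idx j
      |gj|≤j = ℕP.≮⇒≥ λ j<gj → gj≢j (trans (sym (fixes _ j<gj)) (f∘g (pos j)))
  ...   | t , refl , tj≡gj = ts ∷ʳ t , prod≗f , length≡
    where
      open PeelTop f g f∘g g∘f f-odd t fixes (trans (cong f tj≡gj) (f∘g (pos j)))
      f′ = f ∘ act t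
      f′∘g′ : f′ ∘ g′ ≗ id
      f′∘g′ x = trans (cong f (act-involutive t (g x))) (f∘g x)
      g′∘f′ : g′ ∘ f′ ≗ id
      g′∘f′ x = trans (cong (act t) (g∘f (act t x))) (act-involutive t x)
      f′-odd : Odd f′
      f′-odd x = trans (cong f (act-negate t x)) (f-odd (act t x))
      f′-fixes-above : ∀ x → idx j < absℕ x → f′ x ≡ x
      f′-fixes-above x j<x = trans (cong f (act-fixes-above t x j<x)) (fixes x j<x)
      f′j≡j : f′ (pos j) ≡ pos j
      f′j≡j = trans (cong f tj≡gj) (f∘g (pos j))
      rest = rec f′∘g′ g′∘f′ f′-odd (fixes-level j f′-odd f′j≡j f′-fixes-above) (IsCode-peel code)
      ts = proj₁ rest
      prod≗f : prod (ts ∷ʳ t) ≗ f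
      prod≗f x = trans (prod-∷ʳ ts t x) (trans (proj₁ (proj₂ rest) (act t x)) (cong f (act-involutive t x)))
      bj≢j : b j ≢ pos j
      bj≢j bj≡j = gj≢j (trans (sym (trans (IsCode⇒top code) tj≡gj)) bj≡j)
      length≡ : length (ts ∷ʳ t) + count (isMaxᵇ b) ≡ n
      length≡ = begin
        length (ts ∷ʳ t) + count (isMaxᵇ b)          ≡⟨ cong (_+ count (isMaxᵇ b)) (length-++ ts) ⟩
        length ts + 1 + count (isMaxᵇ b)            ≡⟨ ℕP.+-assoc (length ts) 1 _ ⟩
        length ts + suc (count (isMaxᵇ b))          ≡⟨ cong (λ m → length ts + m) (count-withMaxAt b j bj≢j) ⟨
        length ts + count (isMaxᵇ (withMaxAt b j))  ≡⟨ proj₂ (proj₂ rest) ⟩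
        n                                          ∎
        where open ≡-Reasoning

  factorizable : ∀ k → k ≤ n → Factorizable k
  factorizable zero    _   = factorizable-zero
  factorizable (suc k) k<n = subst (Factorizable ∘ suc) (toℕ-fromℕ< k<n)
    (factorizable-suc (fromℕ< k<n) (subst Factorizable (sym (toℕ-fromℕ< k<n)) (factorizable k (ℕP.<⇒≤ k<n))))

-- Orbits

iter-injective : ∀ {A : Set} {h : A → A} → Injective _≡_ _≡_ h → ∀ a → Injective _≡_ _≡_ (iter a h)
iter-injective h-inj zero    e = e
iter-injective h-inj (suc a) e = iter-injective h-inj a (h-inj e)

-- Pigeonhole on the first m + 1 iterates.
periodic : ∀ {A : Set} {m} {encode : A → Fin m} → Injective _≡_ _≡_ encode →
           ∀ {h : A → A} → Injective _≡_ _≡_ h → ∀ x → ∃[ K ] (1 ≤ K × iter K h x ≡ x)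
periodic {m = m} {encode} encode-inj {h} h-inj x
  with i , j , i<j , e ← pigeonhole ℕP.≤-refl (λ k → encode (iter (toℕ k) h x)) =
  toℕ j ∸ toℕ i , ℕP.m<n⇒0<n∸m i<j , sym (iter-injective h-inj (toℕ i) (begin
    iter (toℕ i) h x                          ≡⟨ encode-inj e ⟩
    iter (toℕ j) h x                          ≡⟨ cong (λ k → iter k h x) (ℕP.m+[n∸m]≡n (ℕP.<⇒≤ i<j)) ⟨
    iter (toℕ i + (toℕ j ∸ toℕ i)) h x        ≡⟨ iter-+ (toℕ i) _ h x ⟩
    iter (toℕ i) h (iter (toℕ j ∸ toℕ i) h x) ∎))
  where open ≡-Reasoning

module _ {n : ℕ} where

  private
    toSum : SFin n → Fin n ⊎ Fin n
    toSum (false , a) = inj₁ a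
    toSum (true  , a) = inj₂ a

    toSum-injective : Injective _≡_ _≡_ toSum
    toSum-injective {false , _} {false , _} refl = refl
    toSum-injective {false , _} {true  , _} ()
    toSum-injective {true  , _} {false , _} ()
    toSum-injective {true  , _} {true  , _} refl = refl

  encode : SFin n → Fin (n + n)
  encode = join n n ∘ toSum

  encode-injective : Injective _≡_ _≡_ encode
  encode-injective e = toSum-injective (trans (sym (splitAt-join n n _)) (trans (cong (splitAt n) e) (splitAt-join n n _)))

  FirstEntry-exists : ∀ {h : SFin n → SFin n} {i} m x → absℕ (iter (suc m) h x) ≤ i → ∃[ y ] FirstEntry h i x y
  FirstEntry-exists zero x ≤i = _ , now ≤i
  FirstEntry-exists {h} {i} (suc m) x ≤i with absℕ (h x) ℕ.≤? i
  ... | yes hx≤i = _ , now hx≤i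
  ... | no  hx≰i with y , e ← FirstEntry-exists m (h x) (subst (λ z → absℕ z ≤ i) (iter-sucʳ (suc m) h x) ≤i) =
    y , later (ℕP.≰⇒> hx≰i) e

  code-exists : ∀ {h : SFin n → SFin n} → Injective _≡_ _≡_ h → Σ (Fin n → SFin n) (IsCode h)
  code-exists {h} h-inj = (λ i → proj₁ (entry i)) , (λ i → proj₂ (entry i))
    where
      entry : ∀ i → ∃[ y ] FirstEntry h (idx i) (pos i) y
      entry i with periodic encode-injective h-inj (pos i)
      ... | suc m , _ , hᴷi≡i = FirstEntry-exists m (pos i) (subst (λ z → absℕ z ≤ idx i) (sym hᴷi≡i) ℕP.≤-refl)

  InOrbit : (SFin n → SFin n) → SFin n → SFin n → Set
  InOrbit h p x = ∃[ k ] iter k h p ≡ x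

  Periodic : (SFin n → SFin n) → SFin n → ℕ → Set
  Periodic h p K = 1 ≤ K × iter K h p ≡ p

  -- i ∈ Max b for the code b of h.
  IsMax : (SFin n → SFin n) → Fin n → Set
  IsMax h i = FirstEntry h (idx i) (pos i) (pos i)

  record InvariantAbove (h : SFin n → SFin n) (i : Fin n) (W : SFin n → Set) : Set where
    field
      closed   : ∀ {x} → W x → W (h x)
      coherent : ∀ {x} → W x → W (negate x) → ⊥
      above    : ∀ {x} → W x → idx i ≤ absℕ x

  -- The trajectory of i stays in W, so its first entry at level ≤ i is ±i, and W excludes -i.
  invariant⇒returns : ∀ {h i W} → InvariantAbove h i W → W (pos i) → ∀ {y} → FirstEntry h (idx i) (pos i) y → y ≡ pos i
  invariant⇒returns {h} {i} {W} inv Wi entry = landing _ (reach entry Wi)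
    where
      open InvariantAbove inv
      reach : ∀ {x y} → FirstEntry h (idx i) x y → W x → W y × absℕ y ≤ idx i
      reach (now ≤i)    Wx = closed Wx , ≤i
      reach (later _ e) Wx = reach e (closed Wx)
      landing : ∀ y → W y × absℕ y ≤ idx i → y ≡ pos i
      landing (s , a) (Wy , ≤i) with same-level ≤i (above Wy)
      landing (false , a) _        | refl = refl
      landing (true  , a) (Wy , _) | refl = ⊥-elim (coherent Wi Wy)

  module Orbits (h : SFin n → SFin n) (h-odd : Odd h) where

    iter-odd : ∀ k → Odd (iter k h)
    iter-odd zero    x = refl
    iter-odd (suc k) x = trans (cong h (iter-odd k x)) (h-odd (iter k h x))

    orbit-negate : ∀ {p x} → InOrbit h p x → InOrbit h (negate p) (negate x)
    orbit-negate (k , hᵏp≡x) = k , trans (iter-odd k _) (cong negate hᵏp≡x)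

    orbit-step : ∀ {p x} → InOrbit h p x → InOrbit h p (h x)
    orbit-step (k , hᵏp≡x) = suc k , cong h hᵏp≡x

    periodic-negate : ∀ {p K} → Periodic h p K → Periodic h (negate p) K
    periodic-negate {p} {K} (1≤K , hᴷp≡p) = 1≤K , trans (iter-odd K p) (cong negate hᴷp≡p)

    iter-multiple : ∀ {p K} → Periodic h p K → ∀ q → iter (q * K) h p ≡ p
    iter-multiple per zero = refl
    iter-multiple {p} {K} per (suc q) =
      trans (iter-+ K (q * K) h p) (trans (cong (iter K h) (iter-multiple per q)) (proj₂ per))

    iter-mod : ∀ {p K} → Periodic h p K → ∀ k → ∃[ r ] (r < K × iter k h p ≡ iter r h p)
    iter-mod {p} {suc K} per k = k % suc K , m%n<n k (suc K) , (begin
      iter k h p                                               ≡⟨ cong (λ m → iter m h p) (m≡m%n+[m/n]*n k (suc K)) ⟩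
      iter (k % suc K + k / suc K * suc K) h p                  ≡⟨ iter-+ (k % suc K) _ h p ⟩
      iter (k % suc K) h (iter (k / suc K * suc K) h p)         ≡⟨ cong (iter (k % suc K) h) (iter-multiple per (k / suc K)) ⟩
      iter (k % suc K) h p                                     ∎)
      where open ≡-Reasoning

    orbit-trans : ∀ {p x y} → InOrbit h p x → InOrbit h x y → InOrbit h p y
    orbit-trans {p} (a , refl) (b , refl) = b + a , iter-+ b a h p

    -- Running a periodic point forward by a (K - 1) steps undoes a steps.
    orbit-meet : ∀ {p q x K} → Periodic h q K → InOrbit h p x → InOrbit h q x → InOrbit h p q
    orbit-meet {q = q} {K = suc K} per p↝x (a , refl) = orbit-trans p↝x (a * suc K ∸ a , (begin
      iter (a * suc K ∸ a) h (iter a h q)  ≡⟨ iter-+ (a * suc K ∸ a) a h q ⟨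
      iter (a * suc K ∸ a + a) h q        ≡⟨ cong (λ m → iter m h q) (ℕP.m∸n+n≡m (ℕP.m≤m*n a (suc K))) ⟩
      iter (a * suc K) h q                ≡⟨ iter-multiple per a ⟩
      q                                   ∎))
      where open ≡-Reasoning

    private
      period : ∀ {i} → IsMax h i → ∃[ K ] Periodic h (pos i) K
      period m with K , 1≤K , hᴷi≡i , _ ← FirstEntry⇒iter m = K , 1≤K , hᴷi≡i

    meet-orbit : ∀ {i p x} → IsMax h i → InOrbit h p x → InOrbit h (pos i) x → InOrbit h p (pos i)
    meet-orbit m = orbit-meet (proj₂ (period m))

    meet-neg-orbit : ∀ {i p x} → IsMax h i → InOrbit h p x → InOrbit h (neg i) x → InOrbit h p (neg i)
    meet-neg-orbit m = orbit-meet (periodic-negate (proj₂ (period m)))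

    orbit-strictly-above : ∀ {i x} → IsMax h i → InOrbit h (pos i) x → x ≡ pos i ⊎ idx i < absℕ x
    orbit-strictly-above {i} m (k , refl) with FirstEntry⇒iter m
    ... | K , 1≤K , hᴷi≡i , >i with iter-mod (1≤K , hᴷi≡i) k
    ...   | zero  , _   , hᵏi≡i = inj₁ hᵏi≡i
    ...   | suc r , r<K , hᵏi≡hʳi = inj₂ (subst (λ z → idx i < absℕ z) (sym hᵏi≡hʳi) (>i (suc r) (s≤s z≤n) r<K))

    orbit-above : ∀ {i x} → IsMax h i → InOrbit h (pos i) x → idx i ≤ absℕ x
    orbit-above m o with orbit-strictly-above m o
    ... | inj₁ refl = ℕP.≤-refl
    ... | inj₂ i<x  = ℕP.<⇒≤ i<x

    neg∉orbit : ∀ {i} → IsMax h i → ¬ InOrbit h (pos i) (neg i)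
    neg∉orbit m o with orbit-strictly-above m o
    ... | inj₂ i<i = ℕP.<-irrefl refl i<i

    orbit-coherent : ∀ {i x} → IsMax h i → InOrbit h (pos i) x → InOrbit h (pos i) (negate x) → ⊥
    orbit-coherent m i↝x i↝-x =
      neg∉orbit m (meet-neg-orbit m i↝-x (orbit-negate i↝x))

    orbit-invariant : ∀ {i} → IsMax h i → InvariantAbove h i (InOrbit h (pos i))
    orbit-invariant m = record { closed = orbit-step ; coherent = orbit-coherent m ; above = orbit-above m }

    neg-orbit-invariant : ∀ {i} → IsMax h i → InvariantAbove h i (InOrbit h (neg i))
    neg-orbit-invariant m = record
      { closed   = orbit-step
      ; coherent = λ -i↝x -i↝-x → orbit-coherent m (orbit-negate -i↝x) (orbit-negate -i↝-x)
      ; above    = λ -i↝x → orbit-above m (orbit-negate -i↝x)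
      }

    orbits-disjoint : ∀ {i₁ i₂ x y} → IsMax h i₁ → IsMax h i₂ → i₁ ≢ i₂ →
                      InOrbit h (pos i₁) x → InOrbit h (pos i₂) y → absFin x ≢ absFin y
    orbits-disjoint {i₁} {i₂} {x} {y} m₁ m₂ i₁≢i₂ o₁ o₂ |x|≡|y| with same-absFin x y |x|≡|y|
    ... | inj₁ refl = i₁≢i₂ (same-level (orbit-above m₁ (meet-orbit m₂ o₁ o₂)) (orbit-above m₂ (meet-orbit m₁ o₂ o₁)))
    ... | inj₂ refl = i₁≢i₂ (same-level
      (orbit-above m₁ (meet-neg-orbit m₂ o₁ (subst (InOrbit h (neg i₂)) (negate-involutive x) (orbit-negate o₂))))
      (orbit-above m₂ (meet-neg-orbit m₁ o₂ (orbit-negate o₁))))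

-- Minimality

module _ {n : ℕ} where

  module AfterReflection (g h : SFin n → SFin n) (t : Refl n) (g≗h∘t : ∀ x → g x ≡ h (act t x)) where

    invariant-untouched : ∀ {i W} → InvariantAbove h i W → (∀ x → W x → act t x ≡ x) → InvariantAbove g i W
    invariant-untouched {W = W} inv fixed = record
      { closed   = λ {x} Wx → subst W (sym (trans (g≗h∘t x) (cong h (fixed x Wx)))) (closed Wx)
      ; coherent = coherent
      ; above    = above
      }
      where open InvariantAbove inv

    -- On W₁ ∪ W₂ the reflection t moves only ±x and ±(t x), which it swaps between the two sides.
    invariant-glued : ∀ {i₁ i₂ W₁ W₂ x} → idx i₁ ≤ idx i₂ → InvariantAbove h i₁ W₁ → InvariantAbove h i₂ W₂ →
                      (∀ {w z} → W₁ w → W₂ z → absFin w ≢ absFin z) →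
                      W₁ x → act t x ≢ x → W₂ (act t x) → InvariantAbove g i₁ (λ z → W₁ z ⊎ W₂ z)
    invariant-glued {i₁} {i₂} {W₁} {W₂} {x} i₁≤i₂ inv₁ inv₂ apart W₁x x-moved W₂tx = record
      { closed = closed ; coherent = coherent ; above = above }
      where
        module I₁ = InvariantAbove inv₁
        module I₂ = InvariantAbove inv₂
        ttx≡x = act-involutive t x
        tx-moved : act t (act t x) ≢ act t x
        tx-moved ttx≡tx = x-moved (trans (sym ttx≡tx) ttx≡x)
        closed : ∀ {z} → W₁ z ⊎ W₂ z → W₁ (g z) ⊎ W₂ (g z)
        closed {z} w with act t z ≟S z
        closed {z} (inj₁ W₁z) | yes tz≡z = inj₁ (subst W₁ (sym (trans (g≗h∘t z) (cong h tz≡z))) (I₁.closed W₁z))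
        closed {z} (inj₂ W₂z) | yes tz≡z = inj₂ (subst W₂ (sym (trans (g≗h∘t z) (cong h tz≡z))) (I₂.closed W₂z))
        closed {z} (inj₁ W₁z) | no z-moved
          with same-absFin x z (sym (moved-same-absFin t z x z-moved x-moved (apart W₁z W₂tx)))
        ... | inj₁ refl = inj₂ (subst W₂ (sym (g≗h∘t x)) (I₂.closed W₂tx))
        ... | inj₂ refl = ⊥-elim (I₁.coherent W₁x W₁z)
        closed {z} (inj₂ W₂z) | no z-moved
          with same-absFin (act t x) z (sym (moved-same-absFin t z (act t x) z-moved tx-moved
                                               (λ e → apart W₁x W₂z (sym (trans e (cong absFin ttx≡x))))))
        ... | inj₁ refl = inj₁ (subst W₁ (sym (trans (g≗h∘t (act t x)) (cong h ttx≡x))) (I₁.closed W₁x))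
        ... | inj₂ refl = ⊥-elim (I₂.coherent W₂tx W₂z)
        coherent : ∀ {z} → W₁ z ⊎ W₂ z → W₁ (negate z) ⊎ W₂ (negate z) → ⊥
        coherent (inj₁ W₁z) (inj₁ W₁-z) = I₁.coherent W₁z W₁-z
        coherent (inj₂ W₂z) (inj₂ W₂-z) = I₂.coherent W₂z W₂-z
        coherent (inj₁ W₁z) (inj₂ W₂-z) = apart W₁z W₂-z refl
        coherent (inj₂ W₂z) (inj₁ W₁-z) = apart W₁-z W₂z refl
        above : ∀ {z} → W₁ z ⊎ W₂ z → idx i₁ ≤ absℕ z
        above (inj₁ W₁z) = I₁.above W₁z
        above (inj₂ W₂z) = ℕP.≤-trans i₁≤i₂ (I₂.above W₂z)

    module _ (h-odd : Odd h) where
      open Orbits h h-odd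

      -- Stated with ¬ ≢ so that two-maxima-not-lost can argue by contradiction without
      -- deciding whether t fixes a whole orbit.
      max-kept-if-untouched : ∀ {i y} → IsMax h i → (∀ x → InOrbit h (pos i) x → ¬ act t x ≢ x) →
                              FirstEntry g (idx i) (pos i) y → y ≡ pos i
      max-kept-if-untouched m untouched =
        invariant⇒returns (invariant-untouched (orbit-invariant m) fixed) (0 , refl)
        where fixed = λ x o → decidable-stable (act t x ≟S x) (untouched x o)

      max-kept-if-glued : ∀ {i₁ i₂ x₁ x₂ y} → toℕ i₁ < toℕ i₂ → IsMax h i₁ → IsMax h i₂ →
                          InOrbit h (pos i₁) x₁ → act t x₁ ≢ x₁ → InOrbit h (pos i₂) x₂ → act t x₂ ≢ x₂ →
                          FirstEntry g (idx i₁) (pos i₁) y → y ≡ pos i₁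
      max-kept-if-glued {i₁} {i₂} {x₁} {x₂} {y} i₁<i₂ m₁ m₂ o₁ x₁-moved o₂ x₂-moved entry =
        glued (same-absFin x₂ (act t x₁) |x₂|≡|tx₁|)
        where
          i₁≢i₂ = <⇒≢ i₁<i₂
          i₁≤i₂ = ℕP.<⇒≤ (s≤s i₁<i₂)
          tx₁-moved : act t (act t x₁) ≢ act t x₁
          tx₁-moved e = x₁-moved (trans (sym e) (act-involutive t x₁))
          |x₂|≡|tx₁| : absFin x₂ ≡ absFin (act t x₁)
          |x₂|≡|tx₁| = moved-same-absFin t x₂ (act t x₁) x₂-moved tx₁-moved
            (λ e → orbits-disjoint m₁ m₂ i₁≢i₂ o₁ o₂ (sym (trans e (cong absFin (act-involutive t x₁)))))
          glued : act t x₁ ≡ x₂ ⊎ act t x₁ ≡ negate x₂ → y ≡ pos i₁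
          glued (inj₁ tx₁≡x₂) = invariant⇒returns
            (invariant-glued i₁≤i₂ (orbit-invariant m₁) (orbit-invariant m₂) (orbits-disjoint m₁ m₂ i₁≢i₂)
               o₁ x₁-moved (subst (InOrbit h (pos i₂)) (sym tx₁≡x₂) o₂))
            (inj₁ (0 , refl)) entry
          glued (inj₂ tx₁≡-x₂) = invariant⇒returns
            (invariant-glued i₁≤i₂ (orbit-invariant m₁) (neg-orbit-invariant m₂)
               (λ o o′ → orbits-disjoint m₁ m₂ i₁≢i₂ o (orbit-negate o′))
               o₁ x₁-moved (subst (InOrbit h (neg i₂)) (sym tx₁≡-x₂) (orbit-negate o₂)))
            (inj₁ (0 , refl)) entry

      two-maxima-not-lost : ∀ {i₁ i₂ y₁ y₂} → toℕ i₁ < toℕ i₂ → IsMax h i₁ → IsMax h i₂ →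
                            FirstEntry g (idx i₁) (pos i₁) y₁ → y₁ ≢ pos i₁ →
                            FirstEntry g (idx i₂) (pos i₂) y₂ → y₂ ≢ pos i₂ → ⊥
      two-maxima-not-lost i₁<i₂ m₁ m₂ e₁ lost₁ e₂ lost₂ =
        lost₁ (max-kept-if-untouched m₁ (λ x₁ o₁ x₁-moved →
          lost₂ (max-kept-if-untouched m₂ (λ x₂ o₂ x₂-moved →
            lost₁ (max-kept-if-glued i₁<i₂ m₁ m₂ o₁ x₁-moved o₂ x₂-moved e₁)) e₂)) e₁)

  lower-bound : ∀ ts {g} → prod ts ∘ g ≗ id → g ∘ prod ts ≗ id → ∀ {b} → IsCode g b →
                n ≤ count (isMaxᵇ b) + length ts
  lower-bound [] _ g≗id {b} code = ℕP.≤-reflexive (sym (begin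
    count (isMaxᵇ b) + 0  ≡⟨ ℕP.+-identityʳ _ ⟩
    count (isMaxᵇ b)      ≡⟨ count-all (isMaxᵇ b) (λ i → dec-true (b i ≟S pos i) (IsCode-id⇒all-max g≗id code i)) ⟩
    n                     ∎))
    where open ≡-Reasoning
  lower-bound (t ∷ ts) {g} prod∘g g∘prod {b} code = begin
    n                                   ≤⟨ lower-bound ts prod∘h h∘prod code′ ⟩
    count (isMaxᵇ b′) + length ts       ≤⟨ ℕP.+-monoˡ-≤ (length ts) (count≤count+1 (isMaxᵇ b′) (isMaxᵇ b) one-lost) ⟩
    count (isMaxᵇ b) + 1 + length ts    ≡⟨ ℕP.+-assoc (count (isMaxᵇ b)) 1 (length ts) ⟩
    count (isMaxᵇ b) + length (t ∷ ts)  ∎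
    where
      open ℕP.≤-Reasoning
      h = g ∘ act t
      prod∘h : prod ts ∘ h ≗ id
      prod∘h x = trans (sym (act-involutive t _)) (trans (cong (act t) (prod∘g (act t x))) (act-involutive t x))
      h∘prod : h ∘ prod ts ≗ id
      h∘prod = g∘prod
      code-of-h = code-exists (inverse-injective {f = prod ts} {g = h} prod∘h)
      b′ = proj₁ code-of-h
      code′ = proj₂ code-of-h
      open AfterReflection g h t (λ x → cong g (sym (act-involutive t x)))
      h-odd : Odd h
      h-odd = inverse-odd {f = prod ts} {g = h} prod∘h h∘prod (prod-odd ts)
      max′ : ∀ i → isMaxᵇ b′ i ≡ true → IsMax h i
      max′ i isMaxᵇ-true = subst (FirstEntry h (idx i) (pos i)) (isMaxᵇ⇒≡ b′ i isMaxᵇ-true) (code′ i)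
      one-lost : ∀ i₁ i₂ → i₁ ≢ i₂ → isMaxᵇ b′ i₁ ≡ true → isMaxᵇ b i₁ ≡ false →
                 isMaxᵇ b′ i₂ ≡ true → isMaxᵇ b i₂ ≡ false → ⊥
      one-lost i₁ i₂ i₁≢i₂ max₁ lost₁ max₂ lost₂ with ℕP.<-cmp (toℕ i₁) (toℕ i₂)
      ... | tri< i₁<i₂ _ _ = two-maxima-not-lost h-odd i₁<i₂ (max′ i₁ max₁) (max′ i₂ max₂)
                               (code i₁) (¬isMaxᵇ⇒≢ b i₁ lost₁) (code i₂) (¬isMaxᵇ⇒≢ b i₂ lost₂)
      ... | tri≈ _ i₁≡i₂ _ = i₁≢i₂ (toℕ-injective i₁≡i₂)
      ... | tri> _ _ i₂<i₁ = two-maxima-not-lost h-odd i₂<i₁ (max′ i₂ max₂) (max′ i₁ max₁)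
                               (code i₂) (¬isMaxᵇ⇒≢ b i₂ lost₂) (code i₁) (¬isMaxᵇ⇒≢ b i₁ lost₁)

module _ {n : ℕ} (σ : B n) where

  σ∘σ⁻¹ : app σ ∘ appInv σ ≗ id
  σ∘σ⁻¹ = Inverse.strictlyInverseˡ (B.perm σ)

  σ⁻¹∘σ : appInv σ ∘ app σ ≗ id
  σ⁻¹∘σ = Inverse.strictlyInverseʳ (B.perm σ)

  prod∘σ⁻¹ : ∀ ts → IsReflFactorization σ ts → prod ts ∘ appInv σ ≗ id
  prod∘σ⁻¹ ts prod≗σ x = trans (prod≗σ (appInv σ x)) (σ∘σ⁻¹ x)

  σ⁻¹∘prod : ∀ ts → IsReflFactorization σ ts → appInv σ ∘ prod ts ≗ id
  σ⁻¹∘prod ts prod≗σ x = trans (cong (appInv σ) (prod≗σ x)) (σ⁻¹∘σ x)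

lemma3p6 : (n : ℕ) → 1 ≤ n → (σ : B n) → (b : Fin n → SFin n) → IsBCode σ b →
    ((ts : List (Refl n)) → IsSorFactorization σ ts → sorOf ts ≡ codeSum b)
    × IsReflLength σ (n ∸ maxCount b)
lemma3p6 n _ σ b isB = sor-formula , (ts₀ , prod≗σ , length≡) , minimal
  where
    code = IsBCode⇒IsCode σ b isB
    maxCount≡ : maxCount b ≡ count (isMaxᵇ b)
    maxCount≡ = length-filter-tabulate (λ i → b i ≟S pos i) id

    sor-formula : ∀ ts → IsSorFactorization σ ts → sorOf ts ≡ codeSum b
    sor-formula ts (sorted , prod≗σ) = trans
      (sorOf≡sum-codeTerm (reverseView ts) sorted (prod∘σ⁻¹ σ ts prod≗σ) (σ⁻¹∘prod σ ts prod≗σ) code)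
      (sym (sumℤ-map-allFin (codeTerm b)))

    factorization = factorizable n ℕP.≤-refl (σ∘σ⁻¹ σ) (σ⁻¹∘σ σ) (B.odd σ)
                      (λ x n<x → ⊥-elim (ℕP.<⇒≱ n<x (absℕ≤n x))) code
    ts₀ = proj₁ factorization
    prod≗σ = proj₁ (proj₂ factorization)
    length≡ : length ts₀ ≡ n ∸ maxCount b
    length≡ = trans (sym (ℕP.m+n∸n≡m (length ts₀) (count (isMaxᵇ b))))
                    (cong₂ _∸_ (proj₂ (proj₂ factorization)) (sym maxCount≡))

    minimal : ∀ ts → IsReflFactorization σ ts → n ∸ maxCount b ≤ length ts
    minimal ts prod≗σ = subst (λ c → n ∸ c ≤ length ts) (sym maxCount≡)
      (ℕP.m≤n+o⇒m∸n≤o n (count (isMaxᵇ b)) (lower-bound ts (prod∘σ⁻¹ σ ts prod≗σ) (σ⁻¹∘prod σ ts prod≗σ) code))
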